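{- Let $q\ge1$ and $n\ge1$. There is a bijection between the set of isotopy classes of simply transitive sets of $q$ mutually orthogonal Latin squares of order $n$ (equivalently, simply transitive elements of $(q+2)\text{ -OA}(n)$ up to isotopy) and the set of equivalence classes of disjoint group packets in $(q+2)\text{ -GP}(n)$.
   Context: A set of $q$ MOLS of order $n$ is identified with an orthogonal array in $(q+2)\text{ -OA}(n)$: data $(S,X_i,\pi_i)_{i=1}^{q+2}$ with $|X_i|=n$ and maps $\pi_i\colon S\to X_i$ such that $\pi_i\times\pi_j\colon S\to X_i\times X_j$ is a bijection for all $i\neq j$. An isotopy is a collection of bijections $\sigma\colon S\to S'$, $\sigma_i\colon X_i\to X'_i$ with $\pi'_i\sigma=\sigma_i\pi_i$. Regarding $S\subset\prod_iX_i$ via $\prod_i\pi_i$, the autotopy group is $\mathrm{Aut}(S,X_i)=\{(\sigma_i)\in\prod_i\mathrm{Sym}(X_i):(\sigma_i)(S)=S\}$. The array is simply transitive if some subgroup of $\mathrm{Aut}(S,X_i)$ acts simply transitively on $S$. A group packet in $(q+2)\text{ -GP}(n)$ is $(G,H_i)_{i=1}^{q+2}$ with $G$ a group and $H_i\le G$ such that there is a subgroup $K$ with $H_i\cap H_j=K$ for all $i\ne j$ and $[G:H_i]=[H_i:K]=n$; it is disjoint if $K=\{e\}$. An admissible morphism $(G,H_i)\to(G',H'_i)$ is a homomorphism $\alpha\colon G\to G'$ with $\alpha(H_i)\subset H'_i$ such that each induced map $G/H_i\to G'/H'_i$ is bijective. Two group packets are equivalent if there is a third group packet and admissible morphisms from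 both to it. -}

module Defs where

open import Data.Nat using (ℕ)
open import Data.Fin using (Fin)
open import Data.Unit using (⊤)
open import Data.Product using (Σ; ∃; _×_; _,_; proj₁; proj₂)
open import Relation.Binary.PropositionalEquality using (_≡_)
open import Relation.Nullary using (¬_)
open import Function.Bundles using (_↔_; _⇔_; Inverse)
open import Function.Definitions using (Bijective)
open import Algebra.Structures using (IsGroup)

record OA (m n : ℕ) : Set₁ where
  field
    S      : Set
    X      : Fin m → Set
    π      : (i : Fin m) → S → X i
    X-size : ∀ i → Fin n ↔ X i
    pair-bij : ∀ i j → ¬ (i ≡ j) →
               Bijective {A = S} {B = X i × X j} _≡_ _≡_ (λ s → π i s , π j s)

record Isotopy {m n : ℕ} (A B : OA m n) : Set where
  field
    σ    : OA.S A ↔ OA.S B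
    σi   : ∀ i → OA.X A i ↔ OA.X B i
    comm : ∀ i s → OA.π B i (Inverse.to σ s) ≡ Inverse.to (σi i) (OA.π A i s)

Isotopic : {m n : ℕ} → OA m n → OA m n → Set
Isotopic A B = Isotopy A B

record Grp : Set₁ where
  infixl 7 _∙_
  field
    Carrier : Set
    _∙_     : Carrier → Carrier → Carrier
    ε       : Carrier
    _⁻¹     : Carrier → Carrier
    isGroup : IsGroup _≡_ _∙_ ε _⁻¹

record IsSubgroup (G : Grp) (H : Grp.Carrier G → Set) : Set where
  open Grp G
  field
    ε∈  : H ε
    ∙∈  : ∀ {x y} → H x → H y → H (x ∙ y)
    ⁻¹∈ : ∀ {x} → H x → H (x ⁻¹)

-- [H : K] = n  (K ⊆ H subgroups of G): the left coset space H/K,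
-- x ~ y iff x⁻¹ y ∈ K, is in bijection with Fin n, witnessed by a map
-- f : H → Fin n whose fibres are exactly the cosets and which is onto.
RelIndex : (G : Grp) (H K : Grp.Carrier G → Set) (n : ℕ) → Set
RelIndex G H K n =
  Σ (Σ Carrier H → Fin n) λ f →
    (∀ x y → (f x ≡ f y) ⇔ K ((proj₁ x ⁻¹) ∙ proj₁ y))
    × (∀ i → ∃ λ x → f x ≡ i)
  where open Grp G

Index : (G : Grp) (H : Grp.Carrier G → Set) (n : ℕ) → Set
Index G H n = RelIndex G (λ _ → ⊤) H n

record GP (m n : ℕ) : Set₁ where
  field
    G       : Grp
    H       : Fin m → Grp.Carrier G → Set
    H-sub   : ∀ i → IsSubgroup G (H i)
    K       : Grp.Carrier G → Set
    K-sub   : IsSubgroup G K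
    inter   : ∀ i j → ¬ (i ≡ j) → ∀ g → (H i g × H j g) ⇔ K g
    index-G : ∀ i → Index G (H i) n
    index-H : ∀ i → RelIndex G (H i) K n

Disjoint : {m n : ℕ} → GP m n → Set
Disjoint P = ∀ g → K g ⇔ (g ≡ Grp.ε G)
  where open GP P

-- Admissible morphism P → Q: a group homomorphism α with α(H_i) ⊆ H'_i such
-- that each induced map G/H_i → G'/H'_i (gH_i ↦ α(g)H'_i) is bijective.
record Admissible {m n : ℕ} (P Q : GP m n) : Set where
  module P = GP P
  module Q = GP Q
  module GP' = Grp P.G
  module GQ = Grp Q.G
  field
    α     : GP'.Carrier → GQ.Carrier
    α-hom : ∀ x y → α (x GP'.∙ y) ≡ α x GQ.∙ α y
    α-H   : ∀ i g → P.H i g → Q.H i (α g)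
    ind-inj  : ∀ i x y → Q.H i ((α x GQ.⁻¹) GQ.∙ α y) → P.H i ((x GP'.⁻¹) GP'.∙ y)
    ind-surj : ∀ i y → ∃ λ x → Q.H i ((α x GQ.⁻¹) GQ.∙ y)

Equivalent : {m n : ℕ} → GP m n → GP m n → Set₁
Equivalent {m} {n} P Q = Σ (GP m n) λ R → Admissible P R × Admissible Q R

-- A subgroup of Aut(S, X_i) acting simply transitively on S, presented as a
-- group G with a faithful action on each X_i by autotopies (the tuple
-- (g·)_i maps S ⊂ ∏ X_i into S, recorded by actS with π_i ∘ actS g = actX i g ∘ π_i)
-- such that the induced action on S is simply transitive.
record SimplyTransitive {m n : ℕ} (A : OA m n) : Set₁ where
  open OA A
  field
    G     : Grp
  open Grp G
  field
    actX   : ∀ i → Carrier → X i → X i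
    actX-ε : ∀ i x → actX i ε x ≡ x
    actX-∙ : ∀ i g h x → actX i (g ∙ h) x ≡ actX i g (actX i h x)
    actS   : Carrier → S → S
    compat : ∀ i g s → π i (actS g s) ≡ actX i g (π i s)
    faithful : ∀ g h → (∀ i x → actX i g x ≡ actX i h x) → g ≡ h
    regular  : ∀ s s' → Σ Carrier λ g → actS g s ≡ s' × (∀ h → actS h s ≡ s' → g ≡ h)

STOA : ℕ → ℕ → Set₁
STOA m n = Σ (OA m n) SimplyTransitive

DGP : ℕ → ℕ → Set₁
DGP m n = Σ (GP m n) Disjoint

{-# OPTIONS --safe #-}
module Submission where

-- A simply transitive array with regular group G and base point s₀ gives the disjoint packet
-- of stabilisers (G, Stab (π i s₀)).  Conversely a disjoint packet (G, H i) gives the array of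
-- left cosets (points G, lines G/H i), on which G acts simply transitively by left translation;
-- its stabiliser packet at a point c is the conjugate packet (G, c H i c⁻¹), equivalent to (G, H i).
--
-- If A and B are isotopic, both regular groups embed admissibly into the autotopy group of A,
-- taken with the stabilisers of the lines through a base point.  If instead the packets of A
-- and B map admissibly to a common packet R, labelling each line by the coset in R of the
-- group elements reaching it labels the lines of A and of B compatibly: a point is determined
-- by its labels in two classes, and two points whose labels agree in two classes agree in all,
-- because H 0 ∩ H 1 = K lies in every H i.  Matching labels is then an isotopy.

open import Defs
open import Data.Nat using (ℕ; zero; suc; _+_; _*_; _≤_)
open import Data.Nat.Properties using (<-irrefl)
open import Data.Fin using (Fin; zero; suc; punchOut)
open import Data.Fin.Properties using (all?; any?; _≟_; punchOut-injective; injective⇒≤; *↔×)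
open import Data.Vec using (Vec; lookup; tabulate)
open import Data.Vec.Properties using (lookup∘tabulate; tabulate∘lookup; tabulate-cong)
open import Data.Bool.Properties using (T-irrelevant)
open import Data.Product using (Σ; ∃; _×_; _,_; proj₁; proj₂)
open import Data.Unit using (⊤; tt)
open import Data.Empty using (⊥-elim)
open import Function using (_∘_; id)
open import Function.Bundles using (_↔_; _⇔_; Inverse; Injection; Equivalence; mk⇔; mk↔ₛ′)
open import Function.Definitions using (Injective; StrictlySurjective; Bijective)
open import Function.Properties.Inverse using (↔-refl; ↔-sym; ↔-trans; ↔⇒↣)
open import Function.Consequences.Propositional using (strictlySurjective⇒surjective)
import Function.Properties.Equivalence as ⇔
open import Algebra.Bundles using (Group)
open import Algebra.Structures using (IsGroup)
import Algebra.Properties.Group as GroupProperties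
open import Relation.Binary using (DecidableEquality)
open import Relation.Binary.PropositionalEquality
open import Relation.Nullary using (Dec; yes; no)
open import Relation.Nullary.Decidable using (True; toWitness; fromWitness; map′; _×-dec_; _→-dec_; via-injection)

private
  variable
    q n N : ℕ

module GroupFacts (G : Grp) where
  open Grp G public
  open IsGroup isGroup public using (assoc; identityˡ; identityʳ; inverseˡ; inverseʳ; _\\_; _//_)

  group : Group _ _
  group = record { Carrier = Carrier ; _≈_ = _≡_ ; _∙_ = _∙_ ; ε = ε ; _⁻¹ = _⁻¹ ; isGroup = isGroup }

  open GroupProperties group public
    using (⁻¹-anti-homo-∙; identityʳ-unique; inverseʳ-unique; ∙-cancelˡ; ∙-cancelʳ;
           \\-leftDividesˡ; \\-leftDividesʳ; //-rightDividesˡ)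

  x\\y≡ε⇒x≡y : ∀ {x y} → x \\ y ≡ ε → x ≡ y
  x\\y≡ε⇒x≡y {x} {y} e = begin
    x             ≡⟨ identityʳ x ⟨
    x ∙ ε         ≡⟨ cong (x ∙_) e ⟨
    x ∙ (x \\ y)  ≡⟨ \\-leftDividesˡ x y ⟩
    y             ∎
    where open ≡-Reasoning

  \\-cancelˡ : ∀ g x y → (g ∙ x) \\ (g ∙ y) ≡ x \\ y
  \\-cancelˡ g x y = begin
    (g ∙ x) ⁻¹ ∙ (g ∙ y)        ≡⟨ cong (_∙ (g ∙ y)) (⁻¹-anti-homo-∙ g x) ⟩
    (x ⁻¹ ∙ g ⁻¹) ∙ (g ∙ y)     ≡⟨ assoc _ _ _ ⟩
    x ⁻¹ ∙ (g ⁻¹ ∙ (g ∙ y))     ≡⟨ cong (x ⁻¹ ∙_) (\\-leftDividesʳ g y) ⟩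
    x \\ y                      ∎
    where open ≡-Reasoning

  ≡⇒coset : ∀ {H} → IsSubgroup G H → ∀ {x y} → x ≡ y → H (x \\ y)
  ≡⇒coset {H} H-sub {x} refl = subst H (sym (inverseˡ x)) (IsSubgroup.ε∈ H-sub)

module Homomorphism (G G' : Grp) (α : Grp.Carrier G → Grp.Carrier G')
                    (α-hom : ∀ x y → α (Grp._∙_ G x y) ≡ Grp._∙_ G' (α x) (α y)) where
  private
    module G = GroupFacts G
    module G' = GroupFacts G'

  ε-homo : α G.ε ≡ G'.ε
  ε-homo = G'.identityʳ-unique (α G.ε) (α G.ε) (trans (sym (α-hom _ _)) (cong α (G.identityˡ G.ε)))

  ⁻¹-homo : ∀ x → α (x G.⁻¹) ≡ α x G'.⁻¹
  ⁻¹-homo x = G'.inverseʳ-unique (α x) (α (x G.⁻¹)) (trans (sym (α-hom _ _)) (trans (cong α (G.inverseʳ x)) ε-homo))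

  \\-homo : ∀ x y → α (x G.\\ y) ≡ α x G'.\\ α y
  \\-homo x y = trans (α-hom _ _) (cong (G'._∙ α y) (⁻¹-homo x))

injective⇒strictlySurjective-Fin : (f : Fin N → Fin N) → Injective _≡_ _≡_ f → StrictlySurjective _≡_ f
injective⇒strictlySurjective-Fin {zero}  f f-inj ()
injective⇒strictlySurjective-Fin {suc N} f f-inj y with any? (λ x → f x ≟ y)
... | yes hit = hit
... | no miss = ⊥-elim (<-irrefl refl (injective⇒≤ {f = f-avoiding-y} f-avoiding-y-inj))
  where
  missed : ∀ x → y ≢ f x
  missed x e = miss (x , sym e)
  f-avoiding-y : Fin (suc N) → Fin N
  f-avoiding-y x = punchOut (missed x)
  f-avoiding-y-inj : Injective _≡_ _≡_ f-avoiding-y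
  f-avoiding-y-inj {x} {x'} e = f-inj (punchOut-injective (missed x) (missed x') e)

injections⇒strictlySurjective : {A B : Set} {N : ℕ} → B ↔ Fin N → (f : A → B) (g : B → A) →
                                Injective _≡_ _≡_ f → Injective _≡_ _≡_ g → StrictlySurjective _≡_ f
injections⇒strictlySurjective {N = N} e f g f-inj g-inj y = g (from b) , (begin
  f (g (from b))                ≡⟨ strictlyInverseʳ _ ⟨
  from (to (f (g (from b))))    ≡⟨ cong from hit ⟩
  from (to y)                   ≡⟨ strictlyInverseʳ y ⟩
  y                             ∎)
  where
  open Inverse e
  open ≡-Reasoning
  endo : Fin N → Fin N
  endo = to ∘ f ∘ g ∘ from
  endo-inj : Injective _≡_ _≡_ endo
  endo-inj = Injection.injective (↔⇒↣ (↔-sym e)) ∘ g-inj ∘ f-inj ∘ Injection.injective (↔⇒↣ e)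
  b : Fin N
  b = proj₁ (injective⇒strictlySurjective-Fin endo endo-inj (to y))
  hit : endo b ≡ to y
  hit = proj₂ (injective⇒strictlySurjective-Fin endo endo-inj (to y))

0≢1 : _≢_ {A = Fin (2 + q)} zero (suc zero)
0≢1 ()

another : Fin (2 + q) → Fin (2 + q)
another zero    = suc zero
another (suc _) = zero

≢-another : (i : Fin (2 + q)) → i ≢ another i
≢-another zero    ()
≢-another (suc _) ()

module OAFacts (A : OA (2 + q) n) where
  open OA A public

  fromFin : ∀ i → Fin n → X i
  fromFin i = Inverse.to (X-size i)

  toFin : ∀ i → X i → Fin n
  toFin i = Inverse.from (X-size i)

  toFin-fromFin : ∀ i a → toFin i (fromFin i a) ≡ a
  toFin-fromFin i = Inverse.strictlyInverseʳ (X-size i)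

  toFin-injective : ∀ i {x y} → toFin i x ≡ toFin i y → x ≡ y
  toFin-injective i {x} {y} e = begin
    x                          ≡⟨ Inverse.strictlyInverseˡ (X-size i) x ⟨
    fromFin i (toFin i x)      ≡⟨ cong (fromFin i) e ⟩
    fromFin i (toFin i y)      ≡⟨ Inverse.strictlyInverseˡ (X-size i) y ⟩
    y                          ∎
    where open ≡-Reasoning

  ≡-from-lines : ∀ {i j} → i ≢ j → ∀ {s s'} → π i s ≡ π i s' → π j s ≡ π j s' → s ≡ s'
  ≡-from-lines i≢j e e' = proj₁ (pair-bij _ _ i≢j) (cong₂ _,_ e e')

  ≡-from-all-lines : ∀ {s s'} → (∀ i → π i s ≡ π i s') → s ≡ s'
  ≡-from-all-lines e = ≡-from-lines 0≢1 (e zero) (e (suc zero))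

  module _ {i j} (i≢j : i ≢ j) (x : X i) (y : X j) where
    point : S
    point = proj₁ (proj₂ (pair-bij i j i≢j) (x , y))

    π-point : (π i point , π j point) ≡ (x , y)
    π-point = proj₂ (proj₂ (pair-bij i j i≢j) (x , y)) refl

    π-point₁ : π i point ≡ x
    π-point₁ = cong proj₁ π-point

    π-point₂ : π j point ≡ y
    π-point₂ = cong proj₂ π-point

  -- Any line of the other class will do; X (another i) is inhabited since X i is.
  pointOn : ∀ i → X i → S
  pointOn i x = point (≢-another i) x (fromFin (another i) (toFin i x))

  π-pointOn : ∀ i x → π i (pointOn i x) ≡ x
  π-pointOn i x = π-point₁ (≢-another i) x _

  cell : Fin n × Fin n → S
  cell (a , b) = point 0≢1 (fromFin zero a) (fromFin (suc zero) b)

  cellOf : S → Fin n × Fin n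
  cellOf s = toFin zero (π zero s) , toFin (suc zero) (π (suc zero) s)

  cellOf-cell : ∀ c → cellOf (cell c) ≡ c
  cellOf-cell (a , b) = cong₂ _,_
    (trans (cong (toFin zero) (π-point₁ 0≢1 _ _)) (toFin-fromFin zero a))
    (trans (cong (toFin (suc zero)) (π-point₂ 0≢1 _ _)) (toFin-fromFin (suc zero) b))

  cell-cellOf : ∀ s → cell (cellOf s) ≡ s
  cell-cellOf s = ≡-from-lines 0≢1
    (trans (π-point₁ 0≢1 _ _) (Inverse.strictlyInverseˡ (X-size zero) (π zero s)))
    (trans (π-point₂ 0≢1 _ _) (Inverse.strictlyInverseˡ (X-size (suc zero)) (π (suc zero) s)))

  cell-injective : Injective _≡_ _≡_ cell
  cell-injective {c} {c'} e = trans (sym (cellOf-cell c)) (trans (cong cellOf e) (cellOf-cell c'))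

  S↔Fin[n*n] : S ↔ Fin (n * n)
  S↔Fin[n*n] = ↔-trans (mk↔ₛ′ cellOf cell cellOf-cell cell-cellOf) (↔-sym *↔×)

module _ {m n : ℕ} where
  private
    variable
      A B C : OA m n

  Isotopy-refl : Isotopy A A
  Isotopy-refl = record { σ = ↔-refl ; σi = λ _ → ↔-refl ; comm = λ _ _ → refl }

  Isotopy-sym : Isotopy A B → Isotopy B A
  Isotopy-sym {A} {B} iso = record { σ = ↔-sym σ ; σi = λ i → ↔-sym (σi i) ; comm = comm′ }
    where
    open Isotopy iso
    comm′ : ∀ i t → OA.π A i (Inverse.from σ t) ≡ Inverse.from (σi i) (OA.π B i t)
    comm′ i t = begin
      πA (from σ t)                            ≡⟨ strictlyInverseʳ (σi i) _ ⟨
      from (σi i) (to (σi i) (πA (from σ t)))  ≡⟨ cong (from (σi i)) (comm i _) ⟨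
      from (σi i) (πB (to σ (from σ t)))       ≡⟨ cong (from (σi i) ∘ πB) (strictlyInverseˡ σ t) ⟩
      from (σi i) (πB t)                       ∎
      where
      open ≡-Reasoning
      open Inverse using (to; from; strictlyInverseˡ; strictlyInverseʳ)
      πA : OA.S A → OA.X A i
      πA = OA.π A i
      πB : OA.S B → OA.X B i
      πB = OA.π B i

  Isotopy-trans : Isotopy A B → Isotopy B C → Isotopy A C
  Isotopy-trans σ τ = record
    { σ    = ↔-trans (Isotopy.σ σ) (Isotopy.σ τ)
    ; σi   = λ i → ↔-trans (Isotopy.σi σ i) (Isotopy.σi τ i)
    ; comm = λ i s → trans (Isotopy.comm τ i _) (cong (Inverse.to (Isotopy.σi τ i)) (Isotopy.comm σ i s))
    }

  isotopy-preserves-lines : (iso : Isotopy A B) → ∀ i {s s'} → OA.π A i s ≡ OA.π A i s' →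
                            OA.π B i (Inverse.to (Isotopy.σ iso) s) ≡ OA.π B i (Inverse.to (Isotopy.σ iso) s')
  isotopy-preserves-lines iso i {s} {s'} e =
    trans (comm i s) (trans (cong (Inverse.to (σi i)) e) (sym (comm i s')))
    where open Isotopy iso

record Labelling {m n : ℕ} (A : OA m n) : Set where
  open OA A
  field
    label      : Fin m → S → Fin n
    label≡⇔π≡ : ∀ i s s' → (label i s ≡ label i s') ⇔ (π i s ≡ π i s')

module LabellingFacts {A : OA (2 + q) n} (c : Labelling A) where
  open OAFacts A
  open Labelling c public

  π≡⇒label≡ : ∀ i {s s'} → π i s ≡ π i s' → label i s ≡ label i s'
  π≡⇒label≡ i = Equivalence.from (label≡⇔π≡ i _ _)

  label≡⇒π≡ : ∀ i {s s'} → label i s ≡ label i s' → π i s ≡ π i s'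
  label≡⇒π≡ i = Equivalence.to (label≡⇔π≡ i _ _)

  ≡-from-labels : ∀ {s s'} → label zero s ≡ label zero s' → label (suc zero) s ≡ label (suc zero) s' → s ≡ s'
  ≡-from-labels e e' = ≡-from-lines 0≢1 (label≡⇒π≡ zero e) (label≡⇒π≡ (suc zero) e')

  labels₀₁ : S → Fin n × Fin n
  labels₀₁ s = label zero s , label (suc zero) s

  labels₀₁-injective : Injective _≡_ _≡_ labels₀₁
  labels₀₁-injective e = ≡-from-labels (cong proj₁ e) (cong proj₂ e)

  -- S and Fin n × Fin n have the same size, witnessed by the injection cell.
  labels-onto : ∀ a b → ∃ λ s → label zero s ≡ a × label (suc zero) s ≡ b
  labels-onto a b
    with s , e ← injections⇒strictlySurjective (↔-sym *↔×) labels₀₁ cell labels₀₁-injective cell-injective (a , b)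
    = s , cong proj₁ e , cong proj₂ e

module _ {A B : OA (2 + q) n} where
  open Labelling

  Compatible : Labelling A → Labelling B → Set
  Compatible c d = ∀ s t → label c zero s ≡ label d zero t → label c (suc zero) s ≡ label d (suc zero) t →
                   ∀ i → label c i s ≡ label d i t

Compatible-sym : {A B : OA (2 + q) n} {c : Labelling A} {d : Labelling B} → Compatible c d → Compatible d c
Compatible-sym compatible t s e e' i = sym (compatible s t (sym e) (sym e') i)

module Transfer {A B : OA (2 + q) n} (c : Labelling A) (d : Labelling B) where
  private
    module A = OAFacts A
    module B = OAFacts B
    module c = LabellingFacts c
    module d = LabellingFacts d

  toS : A.S → B.S
  toS s = proj₁ (d.labels-onto (c.label zero s) (c.label (suc zero) s))

  toX : ∀ i → A.X i → B.X i
  toX i x = B.π i (toS (A.pointOn i x))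

  module _ (compatible : Compatible c d) where
    label-toS : ∀ i s → d.label i (toS s) ≡ c.label i s
    label-toS i s = sym (compatible s (toS s) (sym (proj₁ (proj₂ onto))) (sym (proj₂ (proj₂ onto))) i)
      where onto = d.labels-onto (c.label zero s) (c.label (suc zero) s)

    π-toS : ∀ i s → B.π i (toS s) ≡ toX i (A.π i s)
    π-toS i s = d.label≡⇒π≡ i (begin
      d.label i (toS s)                           ≡⟨ label-toS i s ⟩
      c.label i s                                 ≡⟨ c.π≡⇒label≡ i (A.π-pointOn i (A.π i s)) ⟨
      c.label i (A.pointOn i (A.π i s))           ≡⟨ label-toS i _ ⟨
      d.label i (toS (A.pointOn i (A.π i s)))     ∎)
      where open ≡-Reasoning

module _ {A B : OA (2 + q) n} {c : Labelling A} {d : Labelling B} (compatible : Compatible c d) where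
  private
    module A = OAFacts A
    module c = LabellingFacts c
    module A→B = Transfer c d
    module B→A = Transfer d c
    compatible′ : Compatible d c
    compatible′ = Compatible-sym {c = c} {d = d} compatible

  transfer-inverseˡ : ∀ s → B→A.toS (A→B.toS s) ≡ s
  transfer-inverseˡ s = c.≡-from-labels (roundtrip zero) (roundtrip (suc zero))
    where
    roundtrip : ∀ i → c.label i (B→A.toS (A→B.toS s)) ≡ c.label i s
    roundtrip i = trans (B→A.label-toS compatible′ i _) (A→B.label-toS compatible i s)

  transfer-inverseˡ-X : ∀ i x → B→A.toX i (A→B.toX i x) ≡ x
  transfer-inverseˡ-X i x = begin
    B→A.toX i (A→B.toX i x)                  ≡⟨ cong (B→A.toX i ∘ A→B.toX i) (A.π-pointOn i x) ⟨
    B→A.toX i (A→B.toX i (A.π i p))          ≡⟨ cong (B→A.toX i) (A→B.π-toS compatible i p) ⟨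
    B→A.toX i (OA.π B i (A→B.toS p))         ≡⟨ B→A.π-toS compatible′ i _ ⟨
    A.π i (B→A.toS (A→B.toS p))              ≡⟨ cong (A.π i) (transfer-inverseˡ p) ⟩
    A.π i p                                  ≡⟨ A.π-pointOn i x ⟩
    x                                        ∎
    where
    open ≡-Reasoning
    p : A.S
    p = A.pointOn i x

isotopy-from-labels : {A B : OA (2 + q) n} {c : Labelling A} {d : Labelling B} → Compatible c d → Isotopy A B
isotopy-from-labels {c = c} {d} compatible = record
  { σ    = mk↔ₛ′ (Transfer.toS c d) (Transfer.toS d c)
                 (transfer-inverseˡ {c = d} {c} compatible′) (transfer-inverseˡ {c = c} {d} compatible)
  ; σi   = λ i → mk↔ₛ′ (Transfer.toX c d i) (Transfer.toX d c i)
                 (transfer-inverseˡ-X {c = d} {c} compatible′ i) (transfer-inverseˡ-X {c = c} {d} compatible i)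
  ; comm = Transfer.π-toS c d compatible
  }
  where
  compatible′ : Compatible d c
  compatible′ = Compatible-sym {c = c} {d = d} compatible

module GPFacts (P : GP (2 + q) n) where
  open GP P public
  open GroupFacts G public

  cosetIndex : Fin (2 + q) → Carrier → Fin n
  cosetIndex i x = proj₁ (index-G i) (x , tt)

  cosetIndex≡⇔ : ∀ i x y → (cosetIndex i x ≡ cosetIndex i y) ⇔ H i (x \\ y)
  cosetIndex≡⇔ i x y = proj₁ (proj₂ (index-G i)) (x , tt) (y , tt)

  K⊆H : ∀ i {g} → K g → H i g
  K⊆H i {g} = proj₁ ∘ Equivalence.from (inter i (another i) (≢-another i) g)

  cosetIndex-agree : ∀ {x y} → cosetIndex zero x ≡ cosetIndex zero y →
                     cosetIndex (suc zero) x ≡ cosetIndex (suc zero) y → ∀ i → cosetIndex i x ≡ cosetIndex i y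
  cosetIndex-agree {x} {y} e e' i = Equivalence.from (cosetIndex≡⇔ i x y) (K⊆H i x\\y∈K)
    where
    x\\y∈K : K (x \\ y)
    x\\y∈K = Equivalence.to (inter zero (suc zero) 0≢1 _)
      (Equivalence.to (cosetIndex≡⇔ zero x y) e , Equivalence.to (cosetIndex≡⇔ (suc zero) x y) e')

module AdmissibleFacts {P Q : GP (2 + q) n} (α : Admissible P Q) where
  private
    module P = GPFacts P
    module Q = GPFacts Q
  open Admissible α using (α-hom; α-H; ind-inj) renaming (α to φ)
  open Homomorphism P.G Q.G φ α-hom

  coset⇔image-coset : ∀ i x y → P.H i (x P.\\ y) ⇔ Q.H i (φ x Q.\\ φ y)
  coset⇔image-coset i x y = mk⇔ (subst (Q.H i) (\\-homo x y) ∘ α-H i _) (ind-inj i x y)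

isomorphism⇒admissible : {P Q : GP (2 + q) n} →
  let module P = GPFacts P; module Q = GPFacts Q in
  (φ : P.Carrier → Q.Carrier) → (∀ x y → φ (x P.∙ y) ≡ φ x Q.∙ φ y) →
  (φ⁻¹ : Q.Carrier → P.Carrier) → (∀ y → φ (φ⁻¹ y) ≡ y) →
  (∀ i g → P.H i g ⇔ Q.H i (φ g)) → Admissible P Q
isomorphism⇒admissible {P = P} {Q} φ φ-hom φ⁻¹ φφ⁻¹ H⇔H = record
  { α        = φ
  ; α-hom    = φ-hom
  ; α-H      = λ i g → Equivalence.to (H⇔H i g)
  ; ind-inj  = λ i x y → Equivalence.from (H⇔H i _) ∘ subst (Q.H i) (sym (\\-homo x y))
  ; ind-surj = λ i y → φ⁻¹ y , Q.≡⇒coset (Q.H-sub i) (φφ⁻¹ y)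
  }
  where
  module P = GPFacts P
  module Q = GPFacts Q
  open Homomorphism P.G Q.G φ φ-hom

Admissible-refl : {P : GP (2 + q) n} → Admissible P P
Admissible-refl = isomorphism⇒admissible id (λ _ _ → refl) id (λ _ → refl) (λ _ _ → ⇔.refl)

record TransitiveAutotopyAction {m n : ℕ} (A : OA m n) (G : Grp) : Set where
  open OA A
  open Grp G
  field
    act        : Carrier → S → S
    act-ε      : ∀ s → act ε s ≡ s
    act-∙      : ∀ g h s → act (g ∙ h) s ≡ act g (act h s)
    act-lines  : ∀ g i {s s'} → π i s ≡ π i s' → π i (act g s) ≡ π i (act g s')
    transitive : ∀ s s' → ∃ λ g → act g s ≡ s'

module TransitiveAutotopyActionFacts {m n : ℕ} {A : OA m n} {G : Grp} (action : TransitiveAutotopyAction A G) where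
  open OA A
  open GroupFacts G
  open TransitiveAutotopyAction action public

  act-⁻¹-act : ∀ g s → act (g ⁻¹) (act g s) ≡ s
  act-⁻¹-act g s = trans (sym (act-∙ _ _ s)) (trans (cong (λ h → act h s) (inverseˡ g)) (act-ε s))

  act-act-⁻¹ : ∀ g s → act g (act (g ⁻¹) s) ≡ s
  act-act-⁻¹ g s = trans (sym (act-∙ _ _ s)) (trans (cong (λ h → act h s) (inverseʳ g)) (act-ε s))

  act-lines⁻¹ : ∀ g i {s s'} → π i (act g s) ≡ π i (act g s') → π i s ≡ π i s'
  act-lines⁻¹ g i {s} {s'} e = begin
    π i s                        ≡⟨ cong (π i) (act-⁻¹-act g s) ⟨
    π i (act (g ⁻¹) (act g s))   ≡⟨ act-lines (g ⁻¹) i e ⟩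
    π i (act (g ⁻¹) (act g s'))  ≡⟨ cong (π i) (act-⁻¹-act g s') ⟩
    π i s'                       ∎
    where open ≡-Reasoning

module StabiliserPacket {A : OA (2 + q) n} {G : Grp} (action : TransitiveAutotopyAction A G) (s₀ : OA.S A) where
  open OAFacts A
  open GroupFacts G
  open TransitiveAutotopyActionFacts action public

  Stab : Fin (2 + q) → Carrier → Set
  Stab i g = π i (act g s₀) ≡ π i s₀

  Fix : Carrier → Set
  Fix g = act g s₀ ≡ s₀

  Stab-⇔ : ∀ i g h → (π i (act g s₀) ≡ π i (act h s₀)) ⇔ Stab i (g \\ h)
  Stab-⇔ i g h = mk⇔
    (λ e → begin
      π i (act (g \\ h) s₀)               ≡⟨ cong (π i) (act-∙ _ _ s₀) ⟩
      π i (act (g ⁻¹) (act h s₀))          ≡⟨ act-lines (g ⁻¹) i (sym e) ⟩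
      π i (act (g ⁻¹) (act g s₀))          ≡⟨ cong (π i) (act-⁻¹-act g s₀) ⟩
      π i s₀                               ∎)
    (λ e → act-lines⁻¹ (g ⁻¹) i (begin
      π i (act (g ⁻¹) (act g s₀))          ≡⟨ cong (π i) (act-⁻¹-act g s₀) ⟩
      π i s₀                               ≡⟨ e ⟨
      π i (act (g \\ h) s₀)               ≡⟨ cong (π i) (act-∙ _ _ s₀) ⟩
      π i (act (g ⁻¹) (act h s₀))          ∎))
    where open ≡-Reasoning

  Fix-⇔ : ∀ g h → (act g s₀ ≡ act h s₀) ⇔ Fix (g \\ h)
  Fix-⇔ g h = mk⇔
    (λ e → trans (act-∙ _ _ s₀) (trans (cong (act (g ⁻¹)) (sym e)) (act-⁻¹-act g s₀)))
    (λ e → sym (trans (sym (act-act-⁻¹ g _)) (cong (act g) (trans (sym (act-∙ _ _ s₀)) e))))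

  Stab-subgroup : ∀ i → IsSubgroup G (Stab i)
  Stab-subgroup i = record
    { ε∈  = cong (π i) (act-ε s₀)
    ; ∙∈  = λ {g} {h} g∈ h∈ → trans (cong (π i) (act-∙ g h s₀)) (trans (act-lines g i h∈) g∈)
    ; ⁻¹∈ = λ {g} g∈ → act-lines⁻¹ g i (trans (cong (π i) (act-act-⁻¹ g s₀)) (sym g∈))
    }

  Fix-subgroup : IsSubgroup G Fix
  Fix-subgroup = record
    { ε∈  = act-ε s₀
    ; ∙∈  = λ {g} {h} g∈ h∈ → trans (act-∙ g h s₀) (trans (cong (act g) h∈) g∈)
    ; ⁻¹∈ = λ {g} g∈ → trans (cong (act (g ⁻¹)) (sym g∈)) (act-⁻¹-act g s₀)
    }

  Stab∩Stab⇔Fix : ∀ i j → i ≢ j → ∀ g → (Stab i g × Stab j g) ⇔ Fix g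
  Stab∩Stab⇔Fix i j i≢j g =
    mk⇔ (λ (gᵢ , gⱼ) → ≡-from-lines i≢j gᵢ gⱼ) (λ e → cong (π i) e , cong (π j) e)

  index-Stab : ∀ i → Index G (Stab i) n
  index-Stab i = lineIndex , (λ (g , _) (h , _) → same-index⇔coset g h) , onto
    where
    lineIndex : Σ Carrier (λ _ → ⊤) → Fin n
    lineIndex (g , _) = toFin i (π i (act g s₀))
    same-index⇔coset : ∀ g h → (toFin i (π i (act g s₀)) ≡ toFin i (π i (act h s₀))) ⇔ Stab i (g \\ h)
    same-index⇔coset g h = mk⇔ (Equivalence.to (Stab-⇔ i g h) ∘ toFin-injective i)
                               (cong (toFin i) ∘ Equivalence.from (Stab-⇔ i g h))
    onto : ∀ a → ∃ λ x → lineIndex x ≡ a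
    onto a = (g , _) , (begin
      toFin i (π i (act g s₀))                  ≡⟨ cong (toFin i ∘ π i) g-moves ⟩
      toFin i (π i (pointOn i (fromFin i a)))   ≡⟨ cong (toFin i) (π-pointOn i _) ⟩
      toFin i (fromFin i a)                     ≡⟨ toFin-fromFin i a ⟩
      a                                         ∎)
      where
      open ≡-Reasoning
      g : Carrier
      g = proj₁ (transitive s₀ (pointOn i (fromFin i a)))
      g-moves : act g s₀ ≡ pointOn i (fromFin i a)
      g-moves = proj₂ (transitive s₀ (pointOn i (fromFin i a)))

  index-Fix : ∀ i → RelIndex G (Stab i) Fix n
  index-Fix i = crossIndex , (λ (g , g∈) (h , h∈) → same-index⇔coset g∈ h∈) , onto
    where
    j : Fin (2 + q)
    j = another i
    crossIndex : Σ Carrier (Stab i) → Fin n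
    crossIndex (g , _) = toFin j (π j (act g s₀))
    same-index⇔coset : ∀ {g h} → Stab i g → Stab i h →
                       (toFin j (π j (act g s₀)) ≡ toFin j (π j (act h s₀))) ⇔ Fix (g \\ h)
    same-index⇔coset {g} {h} g∈ h∈ = mk⇔
      (λ e → Equivalence.to (Fix-⇔ g h) (≡-from-lines (≢-another i) (trans g∈ (sym h∈)) (toFin-injective j e)))
      (cong (toFin j ∘ π j) ∘ Equivalence.from (Fix-⇔ g h))
    onto : ∀ b → ∃ λ x → crossIndex x ≡ b
    onto b = (g , trans (cong (π i) g-moves) (π-point₁ (≢-another i) _ _))
           , trans (cong (toFin j ∘ π j) g-moves)
                   (trans (cong (toFin j) (π-point₂ (≢-another i) _ _)) (toFin-fromFin j b))
      where
      target : S
      target = point (≢-another i) (π i s₀) (fromFin j b)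
      g : Carrier
      g = proj₁ (transitive s₀ target)
      g-moves : act g s₀ ≡ target
      g-moves = proj₂ (transitive s₀ target)

  packet : GP (2 + q) n
  packet = record
    { G       = G
    ; H       = Stab
    ; H-sub   = Stab-subgroup
    ; K       = Fix
    ; K-sub   = Fix-subgroup
    ; inter   = Stab∩Stab⇔Fix
    ; index-G = index-Stab
    ; index-H = index-Fix
    }

module SimplyTransitiveFacts {A : OA (2 + q) n} (ST : SimplyTransitive A) where
  open OAFacts A
  open SimplyTransitive ST public
  open GroupFacts G public

  actS-ε : ∀ s → actS ε s ≡ s
  actS-ε s = ≡-from-all-lines λ i → trans (compat i ε s) (actX-ε i _)

  actS-∙ : ∀ g h s → actS (g ∙ h) s ≡ actS g (actS h s)
  actS-∙ g h s = ≡-from-all-lines λ i → begin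
    π i (actS (g ∙ h) s)         ≡⟨ compat i _ s ⟩
    actX i (g ∙ h) (π i s)       ≡⟨ actX-∙ i g h _ ⟩
    actX i g (actX i h (π i s))  ≡⟨ cong (actX i g) (compat i h s) ⟨
    actX i g (π i (actS h s))    ≡⟨ compat i g _ ⟨
    π i (actS g (actS h s))      ∎
    where open ≡-Reasoning

  actS-lines : ∀ g i {s s'} → π i s ≡ π i s' → π i (actS g s) ≡ π i (actS g s')
  actS-lines g i {s} {s'} e = trans (compat i g s) (trans (cong (actX i g) e) (sym (compat i g s')))

  translation : S → S → Carrier
  translation s s' = proj₁ (regular s s')

  actS-translation : ∀ s s' → actS (translation s s') s ≡ s'
  actS-translation s s' = proj₁ (proj₂ (regular s s'))

  actS-cancelʳ : ∀ {g h} s → actS g s ≡ actS h s → g ≡ h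
  actS-cancelʳ {g} {h} s e = trans (sym (unique g e)) (unique h refl)
    where unique = proj₂ (proj₂ (regular s (actS h s)))

  action : TransitiveAutotopyAction A G
  action = record
    { act        = actS
    ; act-ε      = actS-ε
    ; act-∙      = actS-∙
    ; act-lines  = actS-lines
    ; transitive = λ s s' → translation s s' , actS-translation s s'
    }

  private
    module Act = TransitiveAutotopyActionFacts action

  actX-act-⁻¹ : ∀ i g x → actX i g (actX i (g ⁻¹) x) ≡ x
  actX-act-⁻¹ i g x = trans (sym (actX-∙ i _ _ x)) (trans (cong (λ h → actX i h x) (inverseʳ g)) (actX-ε i x))

  actX-⁻¹-act : ∀ i g x → actX i (g ⁻¹) (actX i g x) ≡ x
  actX-⁻¹-act i g x = trans (sym (actX-∙ i _ _ x)) (trans (cong (λ h → actX i h x) (inverseˡ g)) (actX-ε i x))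

  autotopyOf : Carrier → Isotopy A A
  autotopyOf g = record
    { σ    = mk↔ₛ′ (actS g) (actS (g ⁻¹)) (Act.act-act-⁻¹ g) (Act.act-⁻¹-act g)
    ; σi   = λ i → mk↔ₛ′ (actX i g) (actX i (g ⁻¹)) (actX-act-⁻¹ i g) (actX-⁻¹-act i g)
    ; comm = λ i → compat i g
    }

  module AtPoint (s₀ : S) where
    open StabiliserPacket action s₀ public

    packet-disjoint : Disjoint packet
    packet-disjoint g = mk⇔ (λ fixes → actS-cancelʳ s₀ (trans fixes (sym (actS-ε s₀))))
                            (λ { refl → actS-ε s₀ })

groupPacket : Fin n → STOA (2 + q) n → DGP (2 + q) n
groupPacket z (A , ST) = packet , packet-disjoint
  where open SimplyTransitiveFacts.AtPoint ST (OAFacts.cell A (z , z))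

module _ (z : Fin n) where

  module _ {A : OA (2 + q) n} (ST : SimplyTransitive A) {R : GP (2 + q) n}
           (α : Admissible (proj₁ (groupPacket z (A , ST))) R) where
    private
      open OAFacts A
      open SimplyTransitiveFacts ST
      open AtPoint (cell (z , z))
      module R = GPFacts R
      open Admissible α using () renaming (α to φ)

    coset-labelling : Labelling A
    coset-labelling = record { label = label ; label≡⇔π≡ = label≡⇔π≡ }
      where
      label : Fin (2 + q) → S → Fin n
      label i s = R.cosetIndex i (φ (translation (cell (z , z)) s))

      label≡⇔π≡ : ∀ i s s' → (label i s ≡ label i s') ⇔ (π i s ≡ π i s')
      label≡⇔π≡ i s s' =
        ⇔.trans (R.cosetIndex≡⇔ i _ _)
        (⇔.trans (⇔.sym (AdmissibleFacts.coset⇔image-coset α i _ _))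
        (⇔.trans (⇔.sym (Stab-⇔ i _ _))
                 (mk⇔ (λ e → trans (sym (moves s)) (trans e (moves s')))
                      (λ e → trans (moves s) (trans e (sym (moves s')))))))
        where
        moves : ∀ t → π i (actS (translation (cell (z , z)) t) (cell (z , z))) ≡ π i t
        moves t = cong (π i) (actS-translation (cell (z , z)) t)

  equivalent⇒isotopic : (A B : STOA (2 + q) n) →
                        Equivalent (proj₁ (groupPacket z A)) (proj₁ (groupPacket z B)) → Isotopic (proj₁ A) (proj₁ B)
  equivalent⇒isotopic (_ , STA) (_ , STB) (R , α , β) =
    isotopy-from-labels {c = coset-labelling STA α} {d = coset-labelling STB β} (λ _ _ → GPFacts.cosetIndex-agree R)

-- Function extensionality is unavailable, so an autotopy is stored as the tables of its
-- action and of its inverse on S ≅ Fin (n * n); equal actions then give equal tables.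
module AutotopyGroup (A : OA (2 + q) n) where
  open OAFacts A
  open Inverse S↔Fin[n*n] using ()
    renaming (to to encode; from to decode; strictlyInverseˡ to encode-decode; strictlyInverseʳ to decode-encode)

  Table : Set
  Table = Vec (Fin (n * n)) (n * n)

  applyTable : Table → S → S
  applyTable t = decode ∘ lookup t ∘ encode

  tableOf : (S → S) → Table
  tableOf f = tabulate (encode ∘ f ∘ decode)

  applyTable-tableOf : ∀ f s → applyTable (tableOf f) s ≡ f s
  applyTable-tableOf f s = begin
    decode (lookup (tabulate (encode ∘ f ∘ decode)) (encode s))  ≡⟨ cong decode (lookup∘tabulate _ (encode s)) ⟩
    decode (encode (f (decode (encode s))))                     ≡⟨ decode-encode _ ⟩
    f (decode (encode s))                                       ≡⟨ cong f (decode-encode s) ⟩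
    f s                                                         ∎
    where open ≡-Reasoning

  applyTable-injective : ∀ {t t'} → (∀ s → applyTable t s ≡ applyTable t' s) → t ≡ t'
  applyTable-injective {t} {t'} e = begin
    t                         ≡⟨ tabulate∘lookup t ⟨
    tabulate (lookup t)       ≡⟨ tabulate-cong same-entry ⟩
    tabulate (lookup t')      ≡⟨ tabulate∘lookup t' ⟩
    t'                        ∎
    where
    open ≡-Reasoning
    entry : ∀ u c → encode (applyTable u (decode c)) ≡ lookup u c
    entry u c = trans (encode-decode _) (cong (lookup u) (encode-decode c))
    same-entry : ∀ c → lookup t c ≡ lookup t' c
    same-entry c = trans (sym (entry t c)) (trans (cong encode (e (decode c))) (entry t' c))

  ∀-dec : {P : S → Set} → (∀ s → Dec (P s)) → Dec (∀ s → P s)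
  ∀-dec {P} P? = map′ (λ h s → subst P (decode-encode s) (h (encode s))) (λ h → h ∘ decode) (all? (P? ∘ decode))

  _≟S_ : DecidableEquality S
  _≟S_ = via-injection (↔⇒↣ S↔Fin[n*n]) _≟_

  _≟X_ : ∀ {i} → DecidableEquality (X i)
  _≟X_ {i} = via-injection (↔⇒↣ (↔-sym (X-size i))) _≟_

  PreservesLines : (S → S) → Set
  PreservesLines f = ∀ i s s' → π i s ≡ π i s' → π i (f s) ≡ π i (f s')

  preservesLines? : ∀ f → Dec (PreservesLines f)
  preservesLines? f =
    all? λ i → ∀-dec λ s → ∀-dec λ s' → (π i s ≟X π i s') →-dec (π i (f s) ≟X π i (f s'))

  IsAutotopy : Table × Table → Set
  IsAutotopy (t , t') = (∀ s → applyTable t (applyTable t' s) ≡ s) × (∀ s → applyTable t' (applyTable t s) ≡ s)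
                      × PreservesLines (applyTable t) × PreservesLines (applyTable t')

  -- Opaque, as otherwise unification unfolds this decision procedure and type-checking takes minutes.
  opaque
    isAutotopy? : ∀ p → Dec (IsAutotopy p)
    isAutotopy? (t , t') = ∀-dec (λ s → _ ≟S s) ×-dec ∀-dec (λ s → _ ≟S s)
                         ×-dec preservesLines? (applyTable t) ×-dec preservesLines? (applyTable t')

  Autotopy : Set
  Autotopy = Σ (Table × Table) (True ∘ isAutotopy?)

  apply apply⁻¹ : Autotopy → S → S
  apply   ((t , _) , _) = applyTable t
  apply⁻¹ ((_ , t') , _) = applyTable t'

  private
    isAutotopy : ∀ x → IsAutotopy (proj₁ x)
    isAutotopy (p , p∈) = toWitness {a? = isAutotopy? p} p∈

  apply-apply⁻¹ : ∀ x s → apply x (apply⁻¹ x s) ≡ s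
  apply-apply⁻¹ x = proj₁ (isAutotopy x)

  apply⁻¹-apply : ∀ x s → apply⁻¹ x (apply x s) ≡ s
  apply⁻¹-apply x = proj₁ (proj₂ (isAutotopy x))

  apply-lines : ∀ x → PreservesLines (apply x)
  apply-lines x = proj₁ (proj₂ (proj₂ (isAutotopy x)))

  apply⁻¹-lines : ∀ x → PreservesLines (apply⁻¹ x)
  apply⁻¹-lines x = proj₂ (proj₂ (proj₂ (isAutotopy x)))

  autotopy-ext : ∀ {x y} → (∀ s → apply x s ≡ apply y s) → x ≡ y
  autotopy-ext {(t , t') , p} {(u , u') , p′} e with applyTable-injective {t} {u} e | applyTable-injective {t'} {u'} e⁻¹
    where
    e⁻¹ : ∀ s → applyTable t' s ≡ applyTable u' s
    e⁻¹ s = begin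
      applyTable t' s                                  ≡⟨ cong (applyTable t') (apply-apply⁻¹ ((u , u') , p′) s) ⟨
      applyTable t' (applyTable u (applyTable u' s))   ≡⟨ cong (applyTable t') (e _) ⟨
      applyTable t' (applyTable t (applyTable u' s))   ≡⟨ apply⁻¹-apply ((t , t') , p) _ ⟩
      applyTable u' s                                  ∎
      where open ≡-Reasoning
  ... | refl | refl = cong ((t , t') ,_) (T-irrelevant p p′)

  autotopy : (f f' : S → S) → (∀ s → f (f' s) ≡ s) → (∀ s → f' (f s) ≡ s) →
             PreservesLines f → PreservesLines f' → Autotopy
  autotopy f f' ff' f'f f-lines f'-lines = (tableOf f , tableOf f') , fromWitness
    ( (λ s → trans (applyTable-tableOf f _) (trans (cong f (applyTable-tableOf f' s)) (ff' s)))
    , (λ s → trans (applyTable-tableOf f' _) (trans (cong f' (applyTable-tableOf f s)) (f'f s)))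
    , tabulated-lines f f-lines
    , tabulated-lines f' f'-lines )
    where
    tabulated-lines : ∀ g → PreservesLines g → PreservesLines (applyTable (tableOf g))
    tabulated-lines g g-lines i s s' e =
      trans (cong (π i) (applyTable-tableOf g s)) (trans (g-lines i s s' e) (cong (π i) (sym (applyTable-tableOf g s'))))

  fromIsotopy : Isotopy A A → Autotopy
  fromIsotopy σ = autotopy (Inverse.to (Isotopy.σ σ)) (Inverse.from (Isotopy.σ σ))
    (Inverse.strictlyInverseˡ (Isotopy.σ σ)) (Inverse.strictlyInverseʳ (Isotopy.σ σ))
    (λ i s s' → isotopy-preserves-lines σ i) (λ i s s' → isotopy-preserves-lines (Isotopy-sym σ) i)

  apply-fromIsotopy : ∀ σ s → apply (fromIsotopy σ) s ≡ Inverse.to (Isotopy.σ σ) s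
  apply-fromIsotopy σ = applyTable-tableOf (Inverse.to (Isotopy.σ σ))

  infixl 7 _∘ᵃ_

  -- Opaque for the same reason as isAutotopy?.
  opaque
    _∘ᵃ_ : Autotopy → Autotopy → Autotopy
    x ∘ᵃ y = autotopy (apply x ∘ apply y) (apply⁻¹ y ∘ apply⁻¹ x)
      (λ s → trans (cong (apply x) (apply-apply⁻¹ y _)) (apply-apply⁻¹ x s))
      (λ s → trans (cong (apply⁻¹ y) (apply⁻¹-apply x _)) (apply⁻¹-apply y s))
      (λ i s s' → apply-lines x i _ _ ∘ apply-lines y i s s')
      (λ i s s' → apply⁻¹-lines y i _ _ ∘ apply⁻¹-lines x i s s')

    idᵃ : Autotopy
    idᵃ = autotopy id id (λ _ → refl) (λ _ → refl) (λ _ _ _ → id) (λ _ _ _ → id)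

    _⁻¹ᵃ : Autotopy → Autotopy
    x ⁻¹ᵃ = autotopy (apply⁻¹ x) (apply x) (apply⁻¹-apply x) (apply-apply⁻¹ x) (apply⁻¹-lines x) (apply-lines x)

    apply-∘ᵃ : ∀ x y s → apply (x ∘ᵃ y) s ≡ apply x (apply y s)
    apply-∘ᵃ x y = applyTable-tableOf (apply x ∘ apply y)

    apply-idᵃ : ∀ s → apply idᵃ s ≡ s
    apply-idᵃ = applyTable-tableOf id

    apply-⁻¹ᵃ : ∀ x s → apply (x ⁻¹ᵃ) s ≡ apply⁻¹ x s
    apply-⁻¹ᵃ x = applyTable-tableOf (apply⁻¹ x)

  isGroup : IsGroup _≡_ _∘ᵃ_ idᵃ _⁻¹ᵃ
  isGroup = record
    { isMonoid = record
      { isSemigroup = record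
        { isMagma = record { isEquivalence = isEquivalence ; ∙-cong = cong₂ _∘ᵃ_ }
        ; assoc   = λ x y w → autotopy-ext λ s → begin
            apply ((x ∘ᵃ y) ∘ᵃ w) s        ≡⟨ apply-∘ᵃ (x ∘ᵃ y) w s ⟩
            apply (x ∘ᵃ y) (apply w s)     ≡⟨ apply-∘ᵃ x y _ ⟩
            apply x (apply y (apply w s))  ≡⟨ cong (apply x) (apply-∘ᵃ y w s) ⟨
            apply x (apply (y ∘ᵃ w) s)     ≡⟨ apply-∘ᵃ x (y ∘ᵃ w) s ⟨
            apply (x ∘ᵃ (y ∘ᵃ w)) s        ∎
        }
      ; identity = (λ x → autotopy-ext λ s → trans (apply-∘ᵃ idᵃ x s) (apply-idᵃ _))
                 , (λ x → autotopy-ext λ s → trans (apply-∘ᵃ x idᵃ s) (cong (apply x) (apply-idᵃ s)))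
      }
    ; inverse = (λ x → autotopy-ext λ s → begin
                    apply (x ⁻¹ᵃ ∘ᵃ x) s      ≡⟨ apply-∘ᵃ (x ⁻¹ᵃ) x s ⟩
                    apply (x ⁻¹ᵃ) (apply x s) ≡⟨ apply-⁻¹ᵃ x _ ⟩
                    apply⁻¹ x (apply x s)     ≡⟨ apply⁻¹-apply x s ⟩
                    s                         ≡⟨ apply-idᵃ s ⟨
                    apply idᵃ s               ∎)
              , (λ x → autotopy-ext λ s → begin
                    apply (x ∘ᵃ x ⁻¹ᵃ) s      ≡⟨ apply-∘ᵃ x (x ⁻¹ᵃ) s ⟩
                    apply x (apply (x ⁻¹ᵃ) s) ≡⟨ cong (apply x) (apply-⁻¹ᵃ x s) ⟩
                    apply x (apply⁻¹ x s)     ≡⟨ apply-apply⁻¹ x s ⟩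
                    s                         ≡⟨ apply-idᵃ s ⟨
                    apply idᵃ s               ∎)
    ; ⁻¹-cong = cong _⁻¹ᵃ
    }
    where open ≡-Reasoning

  group : Grp
  group = record { Carrier = Autotopy ; _∙_ = _∘ᵃ_ ; ε = idᵃ ; _⁻¹ = _⁻¹ᵃ ; isGroup = isGroup }

module Embedding {A B : OA (2 + q) n} (ST : SimplyTransitive B) (τ : Isotopy A B) where
  open AutotopyGroup A
  open SimplyTransitiveFacts ST using (Carrier; _∙_; actS; actS-∙; autotopyOf)
  open Inverse (Isotopy.σ τ) using (to; from; strictlyInverseˡ)

  ι : Carrier → Autotopy
  ι h = fromIsotopy (Isotopy-trans τ (Isotopy-trans (autotopyOf h) (Isotopy-sym τ)))

  apply-ι : ∀ h s → apply (ι h) s ≡ from (actS h (to s))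
  apply-ι h = apply-fromIsotopy (Isotopy-trans τ (Isotopy-trans (autotopyOf h) (Isotopy-sym τ)))

  ι-hom : ∀ g h → ι (g ∙ h) ≡ ι g ∘ᵃ ι h
  ι-hom g h = autotopy-ext λ s → begin
    apply (ι (g ∙ h)) s                         ≡⟨ apply-ι (g ∙ h) s ⟩
    from (actS (g ∙ h) (to s))                  ≡⟨ cong from (actS-∙ g h _) ⟩
    from (actS g (actS h (to s)))               ≡⟨ cong (from ∘ actS g) (strictlyInverseˡ _) ⟨
    from (actS g (to (from (actS h (to s)))))   ≡⟨ apply-ι g _ ⟨
    apply (ι g) (from (actS h (to s)))          ≡⟨ cong (apply (ι g)) (apply-ι h s) ⟨
    apply (ι g) (apply (ι h) s)                 ≡⟨ apply-∘ᵃ (ι g) (ι h) s ⟨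
    apply (ι g ∘ᵃ ι h) s                        ∎
    where open ≡-Reasoning

autotopyAction : {A : OA (2 + q) n} → SimplyTransitive A → TransitiveAutotopyAction A (AutotopyGroup.group A)
autotopyAction {A = A} ST = record
  { act        = apply
  ; act-ε      = apply-idᵃ
  ; act-∙      = apply-∘ᵃ
  ; act-lines  = λ x i → apply-lines x i _ _
  ; transitive = λ s s' → ι (translation s s') , trans (apply-ι _ s) (actS-translation s s')
  }
  where
  open AutotopyGroup A
  open SimplyTransitiveFacts ST using (translation; actS-translation)
  open Embedding ST Isotopy-refl

module _ {A B : OA (2 + q) n} (STA : SimplyTransitive A) (STB : SimplyTransitive B) (τ : Isotopy A B)
         (s₀ : OA.S A) (t₀ : OA.S B) (based : Inverse.to (Isotopy.σ τ) s₀ ≡ t₀) where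
  private
    module R = StabiliserPacket (autotopyAction STA) s₀
    module SB = SimplyTransitiveFacts STB
    module FB = SB.AtPoint t₀
    open AutotopyGroup A using (apply)
    open Embedding STB τ
    open Inverse (Isotopy.σ τ) using (to; from; strictlyInverseˡ; strictlyInverseʳ)

    ι-s₀ : ∀ h → apply (ι h) s₀ ≡ from (SB.actS h t₀)
    ι-s₀ h = trans (apply-ι h s₀) (cong (from ∘ SB.actS h) based)

    from-lines : ∀ i {t t'} → OA.π B i t ≡ OA.π B i t' → OA.π A i (from t) ≡ OA.π A i (from t')
    from-lines = isotopy-preserves-lines (Isotopy-sym τ)

    from-lines⁻¹ : ∀ i {t t'} → OA.π A i (from t) ≡ OA.π A i (from t') → OA.π B i t ≡ OA.π B i t'
    from-lines⁻¹ i {t} {t'} e = begin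
      OA.π B i t                 ≡⟨ cong (OA.π B i) (strictlyInverseˡ t) ⟨
      OA.π B i (to (from t))     ≡⟨ isotopy-preserves-lines τ i e ⟩
      OA.π B i (to (from t'))    ≡⟨ cong (OA.π B i) (strictlyInverseˡ t') ⟩
      OA.π B i t'                ∎
      where open ≡-Reasoning

  embedding-admissible : Admissible FB.packet R.packet
  embedding-admissible = record
    { α        = ι
    ; α-hom    = ι-hom
    ; α-H      = λ i h h∈ → trans (cong (OA.π A i) (ι-s₀ h))
                              (trans (from-lines i h∈) (cong (OA.π A i) from-t₀))
    ; ind-inj  = λ i x y ιx\\ιy∈ → Equivalence.to (FB.Stab-⇔ i x y) (from-lines⁻¹ i (begin
                   OA.π A i (from (SB.actS x t₀))  ≡⟨ cong (OA.π A i) (ι-s₀ x) ⟨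
                   OA.π A i (apply (ι x) s₀)      ≡⟨ Equivalence.from (R.Stab-⇔ i (ι x) (ι y)) ιx\\ιy∈ ⟩
                   OA.π A i (apply (ι y) s₀)      ≡⟨ cong (OA.π A i) (ι-s₀ y) ⟩
                   OA.π A i (from (SB.actS y t₀))  ∎))
    ; ind-surj = λ i r → reaching r , Equivalence.to (R.Stab-⇔ i (ι (reaching r)) r) (cong (OA.π A i) (ι-reaching r))
    }
    where
    from-t₀ : from t₀ ≡ s₀
    from-t₀ = trans (cong from (sym based)) (strictlyInverseʳ s₀)
    reaching : AutotopyGroup.Autotopy A → SB.Carrier
    reaching r = SB.translation t₀ (to (apply r s₀))
    ι-reaching : ∀ r → apply (ι (reaching r)) s₀ ≡ apply r s₀
    ι-reaching r = trans (ι-s₀ (reaching r)) (trans (cong from (SB.actS-translation t₀ _)) (strictlyInverseʳ _))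
    open ≡-Reasoning

isotopic⇒equivalent : (z : Fin n) (A B : STOA (2 + q) n) →
                      Isotopic (proj₁ A) (proj₁ B) → Equivalent (proj₁ (groupPacket z A)) (proj₁ (groupPacket z B))
isotopic⇒equivalent z (A , STA) (B , STB) σ =
  R.packet , embedding-admissible STA STA Isotopy-refl s₀ s₀ refl , embedding-admissible STA STB τ s₀ t₀ based
  where
  module SB = SimplyTransitiveFacts STB
  s₀ : OA.S A
  s₀ = OAFacts.cell A (z , z)
  t₀ : OA.S B
  t₀ = OAFacts.cell B (z , z)
  module R = StabiliserPacket (autotopyAction STA) s₀
  -- Follow σ by the translation of B carrying σ s₀ to t₀, so that base points correspond.
  τ : Isotopy A B
  τ = Isotopy-trans σ (SB.autotopyOf (SB.translation (Inverse.to (Isotopy.σ σ) s₀) t₀))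
  based : Inverse.to (Isotopy.σ τ) s₀ ≡ t₀
  based = SB.actS-translation _ _

module CosetArray (P : GP (2 + q) n) (disjoint : Disjoint P) where
  open GPFacts P

  representative : Fin (2 + q) → Fin n → Carrier
  representative i a = proj₁ (proj₁ (proj₂ (proj₂ (index-G i)) a))

  cosetIndex-representative : ∀ i a → cosetIndex i (representative i a) ≡ a
  cosetIndex-representative i a = proj₂ (proj₂ (proj₂ (index-G i)) a)

  cosetIndex-∙ˡ : ∀ i g {x y} → cosetIndex i x ≡ cosetIndex i y → cosetIndex i (g ∙ x) ≡ cosetIndex i (g ∙ y)
  cosetIndex-∙ˡ i g {x} {y} e = Equivalence.from (cosetIndex≡⇔ i _ _)
    (subst (H i) (sym (\\-cancelˡ g x y)) (Equivalence.to (cosetIndex≡⇔ i x y) e))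

  cosetIndices-injective : ∀ {i j} → i ≢ j → ∀ {x y} →
                           cosetIndex i x ≡ cosetIndex i y → cosetIndex j x ≡ cosetIndex j y → x ≡ y
  cosetIndices-injective {i} {j} i≢j {x} {y} e e' = x\\y≡ε⇒x≡y (Equivalence.to (disjoint _)
    (Equivalence.to (inter i j i≢j _) (Equivalence.to (cosetIndex≡⇔ i x y) e , Equivalence.to (cosetIndex≡⇔ j x y) e')))

  subgroupElement : Fin (2 + q) → Fin n → Carrier
  subgroupElement i b = proj₁ (proj₁ (proj₂ (proj₂ (index-H i)) b))

  subgroupElement∈H : ∀ i b → H i (subgroupElement i b)
  subgroupElement∈H i b = proj₂ (proj₁ (proj₂ (proj₂ (index-H i)) b))

  subgroupElement-injective : ∀ i {b b'} → subgroupElement i b ≡ subgroupElement i b' → b ≡ b'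
  subgroupElement-injective i {b} {b'} e = begin
    b                                  ≡⟨ relativeIndex b ⟨
    proj₁ (index-H i) (element b)      ≡⟨ Equivalence.from (proj₁ (proj₂ (index-H i)) (element b) (element b'))
                                                          (≡⇒coset K-sub e) ⟩
    proj₁ (index-H i) (element b')     ≡⟨ relativeIndex b' ⟩
    b'                                 ∎
    where
    open ≡-Reasoning
    element : Fin n → Σ Carrier (H i)
    element b = proj₁ (proj₂ (proj₂ (index-H i)) b)
    relativeIndex : ∀ b → proj₁ (index-H i) (element b) ≡ b
    relativeIndex b = proj₂ (proj₂ (proj₂ (index-H i)) b)

  -- G is the union of the n cosets of H i, each of size n because K is trivial.
  embed : Fin (2 + q) → Fin n × Fin n → Carrier
  embed i (a , b) = representative i a ∙ subgroupElement i b

  cosetIndex-embed : ∀ i a b → cosetIndex i (embed i (a , b)) ≡ a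
  cosetIndex-embed i a b = trans
    (sym (Equivalence.from (cosetIndex≡⇔ i _ _) (subst (H i) (sym (\\-leftDividesʳ _ _)) (subgroupElement∈H i b))))
    (cosetIndex-representative i a)

  embed-injective : ∀ i → Injective _≡_ _≡_ (embed i)
  embed-injective i {a , b} {a' , b'} e = cong₂ _,_ a≡a' (subgroupElement-injective i (∙-cancelˡ _ _ _
    (trans e (cong (λ c → representative i c ∙ subgroupElement i b') (sym a≡a')))))
    where
    a≡a' : a ≡ a'
    a≡a' = trans (sym (cosetIndex-embed i a b)) (trans (cong (cosetIndex i) e) (cosetIndex-embed i a' b'))

  cosetIndices-bijective : ∀ i j → i ≢ j → Bijective _≡_ _≡_ (λ x → cosetIndex i x , cosetIndex j x)
  cosetIndices-bijective i j i≢j = injective , strictlySurjective⇒surjective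
    (injections⇒strictlySurjective (↔-sym *↔×) _ (embed i) injective (embed-injective i))
    where
    injective : Injective _≡_ _≡_ (λ x → cosetIndex i x , cosetIndex j x)
    injective e = cosetIndices-injective i≢j (cong proj₁ e) (cong proj₂ e)

  array : OA (2 + q) n
  array = record
    { S        = Carrier
    ; X        = λ _ → Fin n
    ; π        = cosetIndex
    ; X-size   = λ _ → ↔-refl
    ; pair-bij = cosetIndices-bijective
    }

  leftTranslation : SimplyTransitive array
  leftTranslation = record
    { G        = G
    ; actX     = λ i g a → cosetIndex i (g ∙ representative i a)
    ; actX-ε   = λ i a → trans (cong (cosetIndex i) (identityˡ _)) (cosetIndex-representative i a)
    ; actX-∙   = λ i g h a → trans (cong (cosetIndex i) (assoc g h _)) (compat i g _)
    ; actS     = _∙_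
    ; compat   = compat
    ; faithful = λ g h same → ∙-cancelʳ ε g h (cosetIndices-injective 0≢1
                   (trans (compat zero g ε) (trans (same zero _) (sym (compat zero h ε))))
                   (trans (compat (suc zero) g ε) (trans (same (suc zero) _) (sym (compat (suc zero) h ε)))))
    ; regular  = λ s s' → s' // s , //-rightDividesˡ s s' ,
                   λ h e → ∙-cancelʳ s _ _ (trans (//-rightDividesˡ s s') (sym e))
    }
    where
    compat : ∀ i g s → cosetIndex i (g ∙ s) ≡ cosetIndex i (g ∙ representative i (cosetIndex i s))
    compat i g s = cosetIndex-∙ˡ i g (sym (cosetIndex-representative i _))

  module _ (z : Fin n) where
    private
      c : Carrier
      c = OAFacts.cell array (z , z)

      conjugate : Carrier → Carrier
      conjugate g = c \\ (g ∙ c)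

      conjugate-hom : ∀ x y → conjugate (x ∙ y) ≡ conjugate x ∙ conjugate y
      conjugate-hom x y = begin
        c \\ ((x ∙ y) ∙ c)                ≡⟨ cong (c \\_) (assoc x y c) ⟩
        c \\ (x ∙ (y ∙ c))                ≡⟨ cong (λ u → c \\ (x ∙ u)) (\\-leftDividesˡ c (y ∙ c)) ⟨
        c \\ (x ∙ (c ∙ (c \\ (y ∙ c))))   ≡⟨ cong (c \\_) (assoc x c _) ⟨
        c \\ ((x ∙ c) ∙ (c \\ (y ∙ c)))   ≡⟨ assoc _ _ _ ⟨
        (c \\ (x ∙ c)) ∙ (c \\ (y ∙ c))   ∎
        where open ≡-Reasoning

    conjugation-admissible : Admissible (proj₁ (groupPacket z (array , leftTranslation))) P
    conjugation-admissible = isomorphism⇒admissible conjugate conjugate-hom (λ y → (c ∙ y) // c)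
      (λ y → trans (cong (c \\_) (//-rightDividesˡ c (c ∙ y))) (\\-leftDividesʳ c y))
      (λ i g → ⇔.trans (mk⇔ sym sym) (cosetIndex≡⇔ i c (g ∙ c)))

    equivalent-to-array : Equivalent (proj₁ (groupPacket z (array , leftTranslation))) P
    equivalent-to-array = P , conjugation-admissible , Admissible-refl

-- Every argument needs only two parallel classes.
corollary3p18 : (q n : ℕ) → 1 ≤ q → 1 ≤ n →
    Σ (STOA (2 + q) n → DGP (2 + q) n) λ F →
      (∀ (A B : STOA (2 + q) n) → Isotopic (proj₁ A) (proj₁ B) → Equivalent (proj₁ (F A)) (proj₁ (F B)))
      × (∀ (A B : STOA (2 + q) n) → Equivalent (proj₁ (F A)) (proj₁ (F B)) → Isotopic (proj₁ A) (proj₁ B))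
      × (∀ (P : DGP (2 + q) n) → Σ (STOA (2 + q) n) λ A → Equivalent (proj₁ (F A)) (proj₁ P))
corollary3p18 q zero    _ ()
corollary3p18 q (suc n) _ _ =
    groupPacket zero
  , isotopic⇒equivalent zero
  , equivalent⇒isotopic zero
  , λ (P , disjoint) → let open CosetArray P disjoint in (array , leftTranslation) , equivalent-to-array zero
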